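{- For every integer $k\ge1$, $\chi'_3(GM(2k))\le12$.
   Context: For even $q$, $C_q$ is regarded as a balanced bipartite graph with $V=(v_1,\dots,v_{q/2})$, $U=(u_1,\dots,u_{q/2})$ and edges $v_iu_i$ and $v_{i+1}u_i$ (indices modulo $q/2$). For balanced bipartite graphs $G_1=(V_1\cup U_1,E_1)$, $G_2=(V_2\cup U_2,E_2)$ with orderings $V_i=(v^i_1,\dots,v^i_{n_i})$, $U_i=(u^i_1,\dots,u^i_{n_i})$, the balanced bipartite product $G_1\bowtie G_2$ has vertex set $V_1\times V_2\cup U_1\times U_2$ and edge set $\{(v^1_j,v^2)(u^1_j,u^2): j\in[n_1],\ v^2u^2\in E_2\}\cup\{(v^1,v^2_j)(u^1,u^2_j): j\in[n_2],\ v^1u^1\in E_1\}$. The Guo–Mohar graph is $GM(n)=C_4\bowtie C_{2n}$. $\chi'_3(H)$ is the least number of colours in an edge-colouring of $H$ in which any two distinct edges at distance at most $3$ in the line graph $L(H)$ receive distinct colours; the distance between two edges is their distance in $L(H)$ (number of vertices in a shortest path joining them, incident edges having distance $1$). -}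

module Defs where

open import Level using (0ℓ)
open import Data.Nat using (ℕ; zero; suc; _*_; _≤_)
open import Data.Fin using (Fin; toℕ)
open import Data.Product using (Σ; _×_; _,_; proj₁; proj₂; ∃)
open import Data.Sum using (_⊎_)
open import Relation.Binary.PropositionalEquality using (_≡_)
open import Relation.Nullary using (¬_)

-- A balanced bipartite graph with ordered sides V = (v_i)_{i ∈ Idx},
-- U = (u_i)_{i ∈ Idx}.  Adj i j means that v_i u_j is an edge.
-- The graph is simple: an edge is determined by its two endpoints.
record BBGraph : Set₁ where
  field
    Idx : Set
    Adj : Idx → Idx → Set
open BBGraph public

-- The cycle C_{2m} as a balanced bipartite graph:
-- V = (v_1..v_m), U = (u_1..u_m), edges v_i u_i and v_{i+1} u_i
-- (indices modulo m).  Here indices are Fin m (0-based).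
-- "a is the successor of b modulo m":
SucMod : {m : ℕ} → Fin m → Fin m → Set
SucMod {m} a b = (toℕ a ≡ suc (toℕ b)) ⊎ ((toℕ a ≡ 0) × (suc (toℕ b) ≡ m))

Cycle : ℕ → BBGraph          -- Cycle m is C_{2m}
Cycle m = record
  { Idx = Fin m
  ; Adj = λ a b → (a ≡ b) ⊎ SucMod a b }

_⋈_ : BBGraph → BBGraph → BBGraph
G₁ ⋈ G₂ = record
  { Idx = Idx G₁ × Idx G₂
  ; Adj = λ { (v¹ , v²) (u¹ , u²) →
        ((v¹ ≡ u¹) × Adj G₂ v² u²) ⊎ ((v² ≡ u²) × Adj G₁ v¹ u¹) } }

GM : ℕ → BBGraph
GM n = Cycle 2 ⋈ Cycle n

Edge : BBGraph → Set
Edge H = Σ (Idx H) λ x → Σ (Idx H) λ y → Adj H x y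

vEnd uEnd : {H : BBGraph} → Edge H → Idx H
vEnd e = proj₁ e
uEnd e = proj₁ (proj₂ e)

SameEdge : {H : BBGraph} → Edge H → Edge H → Set
SameEdge e f = (vEnd e ≡ vEnd f) × (uEnd e ≡ uEnd f)

Touch : {H : BBGraph} → Edge H → Edge H → Set
Touch e f = (vEnd e ≡ vEnd f) ⊎ (uEnd e ≡ uEnd f)

Dist≤3 : {H : BBGraph} → Edge H → Edge H → Set
Dist≤3 {H} e f = Σ (Edge H) λ e₁ → Σ (Edge H) λ e₂ →
  Touch e e₁ × Touch e₁ e₂ × Touch e₂ f

IsDist3Colouring : (H : BBGraph) {k : ℕ} → (Edge H → Fin k) → Set
IsDist3Colouring H c = (e f : Edge H) → ¬ SameEdge e f → Dist≤3 e f → ¬ (c e ≡ c f)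

χ'₃≤ : BBGraph → ℕ → Set
χ'₃≤ H k = Σ (Edge H → Fin k) λ c → IsDist3Colouring H c

{-# OPTIONS --safe #-}
module Submission where

open import Defs
open import Data.Nat using (ℕ; _*_; _≤_)

open import Data.Nat as ℕ using (zero; suc; _<_; z≤n; z<s)
open import Data.Nat.Properties
  using (module ≤-Reasoning; ≤-refl; ≤-trans; +-mono-≤; <⇒≱; m<m+n; m≤m*n; m≤n*m; m≤n+m;
         suc-injective; *-assoc; *-comm)
open import Data.Nat.DivMod using (_%_; _/_; _mod_; m≡m%n+[m/n]*n; m<n*o⇒m/o<n)
open import Data.Integer as ℤ using (ℤ; +_; +0; +[1+_]; -[1+_]; -1ℤ; ∣_∣; _+_; _-_; -_)
open import Data.Integer.Properties
  using (+-injective; pos-+; pos-*; abs-*; ∣i∣≡0⇒i≡0; ∣-i∣≡∣i∣; ∣i+j∣≤∣i∣+∣j∣)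
open import Data.Integer.Tactic.RingSolver using (solve-∀)
open import Data.Fin using (Fin; toℕ; combine)
open import Data.Fin.Patterns using (0F; 1F; 2F)
open import Data.Fin.Properties
  using (toℕ-injective; toℕ<n; toℕ-fromℕ<; combine-injectiveˡ; combine-injectiveʳ)
open import Data.Product using (_×_; _,_; proj₁; proj₂)
open import Data.Sum using (inj₁; inj₂)
open import Relation.Binary.PropositionalEquality
open import Relation.Nullary using (contradiction)

-- Place v_(a,i) at 4i and u_(b,j) at 4j + 2 on the cycle ℤ/4nℤ, and an edge
-- at 4i ± 1, on the side of its u-end.  Every edge then lies within 1 of both
-- of its ends, so edges at distance ≤ 3 in the line graph lie within 6 of each
-- other.  Colour an edge by its kind (straight, or shifted in the first or in
-- the second factor), the C_2m-coordinate of its v-end and the parity of i.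
-- Two edges of one colour have the same offset ±1, hence 4(i′ − i) ≡ d with
-- ∣d∣ ≤ 6 modulo 4n; as i ≡ i′ mod 2 and 8 ∣ 4n, also 8 ∣ d, so d = 0 and
-- i′ = i.  The v-end and the kind of an edge determine its u-end.

record Near (M r : ℕ) (x y : ℤ) : Set where
  constructor near
  field
    step    : ℤ
    winding : ℤ
    ∣step∣≤r : ∣ step ∣ ≤ r
    y≡x+step : y ≡ x + step + winding ℤ.* + M

near-sym : ∀ {M r x y} → Near M r x y → Near M r y x
near-sym {M} {r} {x} (near d q ∣d∣≤r y≡) =
  near (- d) (- q) (subst (_≤ r) (sym (∣-i∣≡∣i∣ d)) ∣d∣≤r)
    (trans (undo x d q (+ M)) (cong (λ y → y + - d + - q ℤ.* + M) (sym y≡)))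
  where
  undo : ∀ x d q M → x ≡ (x + d + q ℤ.* M) + - d + - q ℤ.* M
  undo = solve-∀

near-trans : ∀ {M r s x y z} → Near M r x y → Near M s y z → Near M (r ℕ.+ s) x z
near-trans {M} {x = x} (near d₁ q₁ ∣d₁∣≤r y≡) (near d₂ q₂ ∣d₂∣≤s z≡) =
  near (d₁ + d₂) (q₁ + q₂) (≤-trans (∣i+j∣≤∣i∣+∣j∣ d₁ d₂) (+-mono-≤ ∣d₁∣≤r ∣d₂∣≤s))
    (trans z≡ (trans (cong (λ y → y + d₂ + q₂ ℤ.* + M) y≡) (regroup x d₁ d₂ q₁ q₂ (+ M))))
  where
  regroup : ∀ x d₁ d₂ q₁ q₂ M →
            (x + d₁ + q₁ ℤ.* M) + d₂ + q₂ ℤ.* M ≡ x + (d₁ + d₂) + (q₁ + q₂) ℤ.* M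
  regroup = solve-∀

near-cancelʳ : ∀ {M r x y} c → Near M r (x + c) (y + c) → Near M r x y
near-cancelʳ {M} {x = x} {y} c (near d q ∣d∣≤r eq) = near d q ∣d∣≤r (begin
  y                                ≡⟨ add-sub y c ⟩
  (y + c) - c                      ≡⟨ cong (_- c) eq ⟩
  (x + c + d + q ℤ.* + M) - c      ≡⟨ drop-c x c d q (+ M) ⟩
  x + d + q ℤ.* + M                ∎)
  where
  open ≡-Reasoning
  add-sub : ∀ y c → y ≡ (y + c) - c
  add-sub = solve-∀
  drop-c : ∀ x c d q M → (x + c + d + q ℤ.* M) - c ≡ x + d + q ℤ.* M
  drop-c = solve-∀

*-bounded⇒≡0 : ∀ {a r} n → r < a → a * n ≤ r → n ≡ 0
*-bounded⇒≡0 zero        _   _    = refl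
*-bounded⇒≡0 {a} (suc n) r<a an≤r = contradiction (≤-trans (m≤m*n a (suc n)) an≤r) (<⇒≱ r<a)

near-*-cancel : ∀ {a M r x y} → r < a →
                Near (a * M) r (+ a ℤ.* x) (+ a ℤ.* y) → Near M 0 x y
near-*-cancel {a} {M} {r} {x} {y} r<a (near d q ∣d∣≤r eq) = near +0 q z≤n (begin
  y                                   ≡⟨ split-off y x q (+ M) ⟩
  (y - x - q ℤ.* + M) + x + q ℤ.* + M  ≡⟨ cong (λ t → t + x + q ℤ.* + M) t≡0 ⟩
  +0 + x + q ℤ.* + M                   ≡⟨ reorder x q (+ M) ⟩
  x + +0 + q ℤ.* + M                   ∎)
  where
  open ≡-Reasoning
  split-off : ∀ y x q M → y ≡ (y - x - q ℤ.* M) + x + q ℤ.* M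
  split-off = solve-∀
  reorder : ∀ x q M → +0 + x + q ℤ.* M ≡ x + +0 + q ℤ.* M
  reorder = solve-∀
  isolate : ∀ d ax aM q → d ≡ (ax + d + q ℤ.* aM) - ax - q ℤ.* aM
  isolate = solve-∀
  factor : ∀ a x y q M → a ℤ.* y - a ℤ.* x - q ℤ.* (a ℤ.* M) ≡ a ℤ.* (y - x - q ℤ.* M)
  factor = solve-∀
  d≡a*t : d ≡ + a ℤ.* (y - x - q ℤ.* + M)
  d≡a*t = begin
    d                                                    ≡⟨ isolate d (+ a ℤ.* x) (+ a ℤ.* + M) q ⟩
    (+ a ℤ.* x + d + q ℤ.* aM) - + a ℤ.* x - q ℤ.* aM   ≡⟨ cong (λ z → z - + a ℤ.* x - q ℤ.* aM) (sym eq′) ⟩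
    + a ℤ.* y - + a ℤ.* x - q ℤ.* aM                     ≡⟨ factor (+ a) x y q (+ M) ⟩
    + a ℤ.* (y - x - q ℤ.* + M)                          ∎
    where
    aM = + a ℤ.* + M
    eq′ : + a ℤ.* y ≡ + a ℤ.* x + d + q ℤ.* aM
    eq′ = trans eq (cong (λ z → + a ℤ.* x + d + q ℤ.* z) (pos-* a M))
  t≡0 : y - x - q ℤ.* + M ≡ +0
  t≡0 = ∣i∣≡0⇒i≡0 (*-bounded⇒≡0 _ r<a
          (subst (_≤ r) (trans (cong ∣_∣ d≡a*t) (abs-* (+ a) _)) ∣d∣≤r))

forward-winding⇒≥ : ∀ {n x y u} → + y ≡ + x + +0 + +[1+ u ] ℤ.* + n → n ≤ y
forward-winding⇒≥ {n} {x} {y} {u} eq = begin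
  n                       ≤⟨ m≤n*m n (suc u) ⟩
  suc u * n               ≤⟨ m≤n+m _ (x ℕ.+ 0) ⟩
  x ℕ.+ 0 ℕ.+ suc u * n   ≡⟨ +-injective (trans lift (sym eq)) ⟩
  y                       ∎
  where
  open ≤-Reasoning
  lift : + (x ℕ.+ 0 ℕ.+ suc u * n) ≡ + x + +0 + +[1+ u ] ℤ.* + n
  lift = trans (pos-+ (x ℕ.+ 0) (suc u * n)) (cong₂ _+_ (pos-+ x 0) (pos-* (suc u) n))

near₀⇒≡ : ∀ {n x y} → x < n → y < n → Near n 0 (+ x) (+ y) → x ≡ y
near₀⇒≡ {n} {x} x<n y<n (near +0 +0 _ eq) = +-injective (sym (trans eq (no-winding (+ x) (+ n))))
  where
  no-winding : ∀ x n → x + +0 + +0 ℤ.* n ≡ x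
  no-winding = solve-∀
near₀⇒≡ x<n y<n (near +0 +[1+ u ] _ eq) = contradiction (forward-winding⇒≥ {u = u} eq) (<⇒≱ y<n)
near₀⇒≡ x<n y<n e@(near +0 -[1+ u ] _ _) =
  contradiction (forward-winding⇒≥ {u = u} (Near.y≡x+step (near-sym e))) (<⇒≱ x<n)
near₀⇒≡ _ _ (near +[1+ _ ] _ () _)
near₀⇒≡ _ _ (near -[1+ _ ] _ () _)

mod≡⇒%≡ : ∀ {d} .{{_ : ℕ.NonZero d}} x y → x mod d ≡ y mod d → x % d ≡ y % d
mod≡⇒%≡ x y eq = trans (sym (toℕ-fromℕ< _)) (trans (cong toℕ eq) (toℕ-fromℕ< _))

halve : ∀ z → + z ≡ + (z % 2) + + (z / 2) ℤ.* + 2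
halve z = trans (cong +_ (m≡m%n+[m/n]*n z 2))
                (trans (pos-+ (z % 2) (z / 2 * 2)) (cong (_+_ (+ (z % 2))) (pos-* (z / 2) 2)))

near-same-parity⇒≡ : ∀ {k x y} c → x % 2 ≡ y % 2 → x < 2 * k → y < 2 * k →
                     Near (4 * (2 * k)) 6 (+ 4 ℤ.* + x + c) (+ 4 ℤ.* + y + c) → x ≡ y
near-same-parity⇒≡ {k} {x} {y} c x%2≡y%2 x<2k y<2k x~y = begin
  x                    ≡⟨ m≡m%n+[m/n]*n x 2 ⟩
  x % 2 ℕ.+ x / 2 * 2  ≡⟨ cong₂ (λ p h → p ℕ.+ h * 2) x%2≡y%2 halves≡ ⟩
  y % 2 ℕ.+ y / 2 * 2  ≡⟨ m≡m%n+[m/n]*n y 2 ⟨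
  y                    ∎
  where
  open ≡-Reasoning
  regroup : ∀ p h c → + 4 ℤ.* (p + h ℤ.* + 2) + c ≡ + 8 ℤ.* h + (+ 4 ℤ.* p + c)
  regroup = solve-∀
  split : ∀ z → + 4 ℤ.* + z + c ≡ + 8 ℤ.* + (z / 2) + (+ 4 ℤ.* + (z % 2) + c)
  split z = trans (cong (λ w → + 4 ℤ.* w + c) (halve z)) (regroup (+ (z % 2)) (+ (z / 2)) c)
  halves-near : Near (8 * k) 6 (+ 8 ℤ.* + (x / 2)) (+ 8 ℤ.* + (y / 2))
  halves-near = near-cancelʳ (+ 4 ℤ.* + (x % 2) + c)
    (subst₂ (Near (8 * k) 6) (split x)
            (trans (split y) (cong (λ p → + 8 ℤ.* + (y / 2) + (+ 4 ℤ.* + p + c)) (sym x%2≡y%2)))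
            (subst (λ M → Near M 6 (+ 4 ℤ.* + x + c) (+ 4 ℤ.* + y + c)) (sym (*-assoc 4 2 k)) x~y))
  half< : ∀ {z} → z < 2 * k → z / 2 < k
  half< {z} z<2k = m<n*o⇒m/o<n (subst (z <_) (*-comm 2 k) z<2k)
  halves≡ : x / 2 ≡ y / 2
  halves≡ = near₀⇒≡ (half< x<2k) (half< y<2k) (near-*-cancel (m<m+n 6 {2} z<s) halves-near)

sucMod-functional : ∀ {m} {a b b′ : Fin m} → SucMod a b → SucMod a b′ → b ≡ b′
sucMod-functional (inj₁ a≡1+b) (inj₁ a≡1+b′) =
  toℕ-injective (suc-injective (trans (sym a≡1+b) a≡1+b′))
sucMod-functional (inj₂ (_ , 1+b≡m)) (inj₂ (_ , 1+b′≡m)) =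
  toℕ-injective (suc-injective (trans 1+b≡m (sym 1+b′≡m)))
sucMod-functional (inj₁ a≡1+b) (inj₂ (a≡0 , _)) with () ← trans (sym a≡1+b) a≡0
sucMod-functional (inj₂ (a≡0 , _)) (inj₁ a≡1+b′) with () ← trans (sym a≡1+b′) a≡0

data Kind : Set where
  straight shift₁ shift₂ : Kind

kindIndex : Kind → Fin 3
kindIndex straight = 0F
kindIndex shift₁   = 1F
kindIndex shift₂   = 2F

kindIndex-injective : ∀ {κ κ′} → kindIndex κ ≡ kindIndex κ′ → κ ≡ κ′
kindIndex-injective {straight} {straight} _ = refl
kindIndex-injective {shift₁}   {shift₁}   _ = refl
kindIndex-injective {shift₂}   {shift₂}   _ = refl
kindIndex-injective {straight} {shift₁}   ()
kindIndex-injective {straight} {shift₂}   ()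
kindIndex-injective {shift₁}   {straight} ()
kindIndex-injective {shift₁}   {shift₂}   ()
kindIndex-injective {shift₂}   {straight} ()
kindIndex-injective {shift₂}   {shift₁}   ()

code : ∀ {m} → Kind → Fin m → Fin 2 → Fin (3 * m * 2)
code κ a p = combine (combine (kindIndex κ) a) p

code-injective : ∀ {m κ κ′} {a a′ : Fin m} {p p′} →
                 code κ a p ≡ code κ′ a′ p′ → κ ≡ κ′ × a ≡ a′ × p ≡ p′
code-injective {κ = κ} {κ′} {a} {a′} {p} {p′} eq =
  kindIndex-injective (combine-injectiveˡ (kindIndex κ) a (kindIndex κ′) a′ κa≡κ′a′) ,
  combine-injectiveʳ (kindIndex κ) a (kindIndex κ′) a′ κa≡κ′a′ ,
  combine-injectiveʳ (combine (kindIndex κ) a) p (combine (kindIndex κ′) a′) p′ eq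
  where
  κa≡κ′a′ : combine (kindIndex κ) a ≡ combine (kindIndex κ′) a′
  κa≡κ′a′ = combine-injectiveˡ (combine (kindIndex κ) a) p (combine (kindIndex κ′) a′) p′ eq

bias : Kind → ℤ
bias straight = + 1
bias shift₁   = + 1
bias shift₂   = -1ℤ

data Link {m n : ℕ} : Kind → Fin m × Fin n → Fin m × Fin n → Set where
  straight : ∀ {v} → Link straight v v
  shift₁   : ∀ {a b i} → SucMod a b → Link shift₁ (a , i) (b , i)
  shift₂   : ∀ {a i j} → SucMod i j → Link shift₂ (a , i) (a , j)

link-functional : ∀ {m n κ} {v u u′ : Fin m × Fin n} → Link κ v u → Link κ v u′ → u ≡ u′
link-functional straight   straight    = refl
link-functional (shift₁ s) (shift₁ s′) = cong (_, _) (sucMod-functional s s′)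
link-functional (shift₂ s) (shift₂ s′) = cong (_ ,_) (sucMod-functional s s′)

module _ {n : ℕ} where

  vPos : Fin n → ℤ
  vPos i = + 4 ℤ.* + toℕ i

  uPos : Fin n → ℤ
  uPos j = + 4 ℤ.* + toℕ j + + 2

  same-index-near : ∀ i → Near (4 * n) 1 (vPos i + + 1) (uPos i)
  same-index-near i = near (+ 1) +0 ≤-refl (step-up (vPos i) (+ (4 * n)))
    where
    step-up : ∀ p M → p + + 2 ≡ p + + 1 + + 1 + +0 ℤ.* M
    step-up = solve-∀

  link-near-uPos : ∀ {m κ} {a b : Fin m} {i j} → Link κ (a , i) (b , j) →
                   Near (4 * n) 1 (vPos i + bias κ) (uPos j)
  link-near-uPos {i = i} straight   = same-index-near i
  link-near-uPos {i = i} (shift₁ _) = same-index-near i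
  link-near-uPos {i = i} {j} (shift₂ (inj₁ i≡1+j)) = near -1ℤ +0 ≤-refl (begin
    uPos j                                                  ≡⟨ step-down (+ toℕ j) (+ (4 * n)) ⟩
    + 4 ℤ.* (+ 1 + + toℕ j) + -1ℤ + -1ℤ + +0 ℤ.* + (4 * n)  ≡⟨ cong (λ z → + 4 ℤ.* z + -1ℤ + -1ℤ + +0 ℤ.* + (4 * n)) 1+j≡i ⟩
    vPos i + -1ℤ + -1ℤ + +0 ℤ.* + (4 * n)                   ∎)
    where
    open ≡-Reasoning
    step-down : ∀ J M → + 4 ℤ.* J + + 2 ≡ + 4 ℤ.* (+ 1 + J) + -1ℤ + -1ℤ + +0 ℤ.* M
    step-down = solve-∀
    1+j≡i : + 1 + + toℕ j ≡ + toℕ i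
    1+j≡i = sym (trans (cong +_ i≡1+j) (pos-+ 1 (toℕ j)))
  link-near-uPos {i = i} {j} (shift₂ (inj₂ (i≡0 , 1+j≡n))) = near -1ℤ (+ 1) ≤-refl (begin
    uPos j                                                       ≡⟨ wrap-around (+ toℕ j) ⟩
    + 4 ℤ.* +0 + -1ℤ + -1ℤ + + 1 ℤ.* (+ 4 ℤ.* (+ 1 + + toℕ j))
      ≡⟨ cong₂ (λ z M → + 4 ℤ.* z + -1ℤ + -1ℤ + + 1 ℤ.* M) (cong +_ (sym i≡0)) 4[1+j]≡4n ⟩
    vPos i + -1ℤ + -1ℤ + + 1 ℤ.* + (4 * n)                       ∎)
    where
    open ≡-Reasoning
    wrap-around : ∀ J → + 4 ℤ.* J + + 2 ≡ + 4 ℤ.* +0 + -1ℤ + -1ℤ + + 1 ℤ.* (+ 4 ℤ.* (+ 1 + J))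
    wrap-around = solve-∀
    4[1+j]≡4n : + 4 ℤ.* (+ 1 + + toℕ j) ≡ + (4 * n)
    4[1+j]≡4n = trans (cong (+ 4 ℤ.*_) (sym (pos-+ 1 (toℕ j))))
                      (trans (sym (pos-* 4 (suc (toℕ j)))) (cong (λ z → + (4 * z)) 1+j≡n))

module _ {m n : ℕ} where

  kind : Edge (Cycle m ⋈ Cycle n) → Kind
  kind (_ , _ , inj₁ (_ , inj₁ _)) = straight
  kind (_ , _ , inj₁ (_ , inj₂ _)) = shift₂
  kind (_ , _ , inj₂ (_ , inj₁ _)) = straight
  kind (_ , _ , inj₂ (_ , inj₂ _)) = shift₁

  link : (e : Edge (Cycle m ⋈ Cycle n)) → Link (kind e) (vEnd e) (uEnd e)
  link ((a , i) , (b , j) , inj₁ (refl , inj₁ refl)) = straight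
  link ((a , i) , (b , j) , inj₁ (refl , inj₂ s))    = shift₂ s
  link ((a , i) , (b , j) , inj₂ (refl , inj₁ refl)) = straight
  link ((a , i) , (b , j) , inj₂ (refl , inj₂ s))    = shift₁ s

  vIndex uIndex : Edge (Cycle m ⋈ Cycle n) → Fin n
  vIndex e = proj₂ (vEnd e)
  uIndex e = proj₂ (uEnd e)

  ePos : Edge (Cycle m ⋈ Cycle n) → ℤ
  ePos e = vPos (vIndex e) + bias (kind e)

  ePos-near-vEnd : (e : Edge (Cycle m ⋈ Cycle n)) → Near (4 * n) 1 (ePos e) (vPos (vIndex e))
  ePos-near-vEnd e =
    near-sym (near (bias (kind e)) +0 (∣bias∣≤1 (kind e)) (no-winding (ePos e) (+ (4 * n))))
    where
    no-winding : ∀ p M → p ≡ p + +0 ℤ.* M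
    no-winding = solve-∀
    ∣bias∣≤1 : ∀ κ → ∣ bias κ ∣ ≤ 1
    ∣bias∣≤1 straight = ≤-refl
    ∣bias∣≤1 shift₁   = ≤-refl
    ∣bias∣≤1 shift₂   = ≤-refl

  ePos-near-uEnd : (e : Edge (Cycle m ⋈ Cycle n)) → Near (4 * n) 1 (ePos e) (uPos (uIndex e))
  ePos-near-uEnd e = link-near-uPos (link e)

  touch-near : (e f : Edge (Cycle m ⋈ Cycle n)) → Touch {Cycle m ⋈ Cycle n} e f →
               Near (4 * n) 2 (ePos e) (ePos f)
  touch-near e f (inj₁ v≡) = near-trans (ePos-near-vEnd e)
    (near-sym (subst (λ v → Near (4 * n) 1 (ePos f) (vPos (proj₂ v))) (sym v≡) (ePos-near-vEnd f)))
  touch-near e f (inj₂ u≡) = near-trans (ePos-near-uEnd e)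
    (near-sym (subst (λ u → Near (4 * n) 1 (ePos f) (uPos (proj₂ u))) (sym u≡) (ePos-near-uEnd f)))

  dist≤3-near : (e f : Edge (Cycle m ⋈ Cycle n)) → Dist≤3 {Cycle m ⋈ Cycle n} e f →
                Near (4 * n) 6 (ePos e) (ePos f)
  dist≤3-near e f (e₁ , e₂ , e~e₁ , e₁~e₂ , e₂~f) =
    near-trans (near-trans (touch-near e e₁ e~e₁) (touch-near e₁ e₂ e₁~e₂)) (touch-near e₂ f e₂~f)

  colour : Edge (Cycle m ⋈ Cycle n) → Fin (3 * m * 2)
  colour e = code (kind e) (proj₁ (vEnd e)) (toℕ (vIndex e) mod 2)

colour-isDist3Colouring : ∀ m k → IsDist3Colouring (Cycle m ⋈ Cycle (2 * k)) (colour {m} {2 * k})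
colour-isDist3Colouring m k e f e≉f e~f same-colour
  with code-injective same-colour
... | κ≡ , a≡ , parity≡ = e≉f (v≡ , u≡)
  where
  i≡ : vIndex e ≡ vIndex f
  i≡ = toℕ-injective (near-same-parity⇒≡ {k} (bias (kind e))
         (mod≡⇒%≡ (toℕ (vIndex e)) (toℕ (vIndex f)) parity≡) (toℕ<n (vIndex e)) (toℕ<n (vIndex f))
         (subst (λ κ → Near (4 * (2 * k)) 6 (ePos e) (vPos (vIndex f) + bias κ)) (sym κ≡)
                (dist≤3-near e f e~f)))
  v≡ : vEnd e ≡ vEnd f
  v≡ = cong₂ _,_ a≡ i≡
  u≡ : uEnd e ≡ uEnd f
  u≡ = link-functional (link e) (subst₂ (λ κ v → Link κ v (uEnd f)) (sym κ≡) (sym v≡) (link f))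

Cycle⋈evenCycle-χ'₃≤ : ∀ m k → χ'₃≤ (Cycle m ⋈ Cycle (2 * k)) (3 * m * 2)
Cycle⋈evenCycle-χ'₃≤ m k = colour , colour-isDist3Colouring m k

lemma4p9 : (k : ℕ) → 1 ≤ k → χ'₃≤ (GM (2 * k)) 12
-- GM 0 is empty, so the bound needs no assumption on k.
lemma4p9 k _ = Cycle⋈evenCycle-χ'₃≤ 2 k
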